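{- Let $d\ge 1$ and let $n_1,\dots,n_d\ge 0$ be integers. Let $P_{n_1\times n_2\times\cdots\times n_d}(z)$ denote the domination polynomial of the $d$-dimensional king graph $K_{n_1\times n_2\times\cdots\times n_d}$. Then \[ P_{n_1\times n_2\times\cdots\times n_d}(-1) = (-1)^{\lceil n_1/2\rceil \lceil n_2/2\rceil\cdots\lceil n_d/2\rceil}. \]
   Context: For integers $n_1,\dots,n_d\ge 0$, the $d$-dimensional king graph $K_{n_1\times\cdots\times n_d}=(V,E)$ has vertex set $V=[n_1]\times\cdots\times[n_d]$, where $[k]=\{1,\dots,k\}$, and $(u,v)\in E$ if and only if $\max_{i\in[d]}|u_i-v_i|=1$ (equivalently, it is the strong product of paths on $n_1,\dots,n_d$ vertices). A dominating set of a graph $G=(V,E)$ is a subset $S\subseteq V$ such that every vertex of $V$ is in $S$ or has a neighbor in $S$. The domination polynomial of $G$ is $P_G(z)=\sum_{S\subseteq V,\ S\text{ dominating}} z^{|S|}$. -}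

module Defs where

open import Data.Bool using (Bool; true; false; T)
open import Data.Nat as ℕ using (ℕ; suc; ⌈_/2⌉; ∣_-_∣; _⊔_; _≡ᵇ_)
open import Data.Integer as ℤ using (ℤ; _^_)
open import Data.List as List using (List; []; _∷_; _++_; map; concatMap; filter; length; upTo)
open import Data.List.Relation.Unary.All using (All; all?)
open import Data.List.Relation.Unary.Any using (Any; any?)
open import Data.Nat.ListAction using (product)
open import Data.Vec as Vec using (Vec; []; _∷_; zipWith; toList)
open import Data.Vec.Properties using (≡-dec)
open import Data.Sum using (_⊎_)
open import Relation.Nullary using (Dec; yes; no; _⊎-dec_)
open import Relation.Nullary.Decidable using (T?)
open import Relation.Binary.PropositionalEquality using (_≡_)
open import Relation.Binary.Definitions using (DecidableEquality)

-- A finite simple graph given by an explicit duplicate-free list of its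
-- vertices, decidable equality on vertices, and a Boolean adjacency test.
record FinGraph : Set₁ where
  field
    V        : Set
    _≟V_     : DecidableEquality V
    vertices : List V
    adj      : V → V → Bool

  Adj : V → V → Set
  Adj u v = T (adj u v)

  DominatedBy : List V → V → Set
  DominatedBy S v = Any (v ≡_) S ⊎ Any (λ u → Adj v u) S

  Dominating : List V → Set
  Dominating S = All (DominatedBy S) vertices

  dominating? : (S : List V) → Dec (Dominating S)
  dominating? S = all? (λ v → any? (v ≟V_) S ⊎-dec any? (λ u → T? (adj v u)) S) vertices

subsets : {A : Set} → List A → List (List A)
subsets []       = [] ∷ []
subsets (x ∷ xs) = subsets xs ++ map (x ∷_) (subsets xs)

sumℤ : List ℤ → ℤ
sumℤ = List.foldr ℤ._+_ (ℤ.+ 0)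

dominationPolyAt : (G : FinGraph) → ℤ → ℤ
dominationPolyAt G z =
  sumℤ (map (λ S → z ^ length S) (filter dominating? (subsets vertices)))
  where open FinGraph G

-- vertices of the king graph: Vec ℕ d with i-th coordinate in [n_i] = {1,…,n_i}
kingVertices : {d : ℕ} → Vec ℕ d → List (Vec ℕ d)
kingVertices []       = [] ∷ []
kingVertices (m ∷ ns) =
  concatMap (λ a → map (a ∷_) (kingVertices ns)) (map suc (upTo m))

maxDist : {d : ℕ} → Vec ℕ d → Vec ℕ d → ℕ
maxDist u v = Vec.foldr _ _⊔_ 0 (zipWith ∣_-_∣ u v)

kingGraph : {d : ℕ} → Vec ℕ d → FinGraph
kingGraph {d} n = record
  { V        = Vec ℕ d
  ; _≟V_     = ≡-dec ℕ._≟_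
  ; vertices = kingVertices n
  ; adj      = λ u v → maxDist u v ≡ᵇ 1
  }

ceilHalfProduct : {d : ℕ} → Vec ℕ d → ℕ
ceilHalfProduct n = product (toList (Vec.map ⌈_/2⌉ n))

-- Write P₋₁(V) for the alternating sum of (-1)^|S| over the sets S that
-- dominate the king graph induced on V. Slice the box into layers, copies of
-- a box H of one dimension less. If layers a and a+1 lie below the rest R,
-- then S = t₁ ∪ t₂ ∪ r (split by layer) dominates iff t₁ ∪ t₂ dominates H
-- and t₂ ∪ r dominates R. For t₂ ≠ ∅ the sum over t₁ vanishes: toggling an
-- element of t₂ inside t₁ flips the sign without affecting domination. Hence
-- P₋₁(a, a+1, R) = P₋₁(H) P₋₁(R), a box of m layers has P₋₁ = P₋₁(H)^⌈m/2⌉, and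
-- induction on the dimension finishes.
module Submission where

open import Defs
open import Data.Nat using (ℕ; _≤_)
open import Data.Integer using (ℤ; -1ℤ; _^_)
open import Data.Vec using (Vec)
open import Relation.Binary.PropositionalEquality using (_≡_)

import Data.Integer.Properties as ℤ
open import Algebra.Properties.CommutativeSemigroup ℤ.+-commutativeSemigroup
  using () renaming (interchange to +-interchange)
open import Algebra.Properties.CommutativeSemigroup ℤ.*-commutativeSemigroup
  using () renaming (interchange to *-interchange)
open import Data.Bool using (T)
open import Data.Empty using (⊥-elim)
open import Data.Integer using (0ℤ; 1ℤ; _+_; _*_; -_)
open import Data.List using (List; []; _∷_; _++_; map; length; filter; upTo; applyUpTo; concatMap)
import Data.List.Properties as List
open import Data.List.Membership.Propositional using (_∈_)
open import Data.List.Membership.Propositional.Properties using (∈-∃++; ∈-++⁺ʳ)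
open import Data.List.Relation.Binary.Permutation.Propositional.Properties using (shift)
open import Data.List.Relation.Binary.Subset.Propositional using (_⊆_)
open import Data.List.Relation.Binary.Subset.Propositional.Properties
  using (⊆-refl; ⊆-trans; ⊆-reflexive-↭; Any-resp-⊆; xs⊆x∷xs; ∈-∷⁺ʳ; ++⁺ˡ; ++⁺ʳ)
open import Data.List.Relation.Unary.All as All using (All; []; _∷_; all?)
import Data.List.Relation.Unary.All.Properties as All
open import Data.List.Relation.Unary.Any as Any using (Any; here; there; any?)
import Data.List.Relation.Unary.Any.Properties as Any
open import Data.Nat using (zero; suc; _<_; z≤n; s≤s; _≤?_; _≡ᵇ_; ∣_-_∣; ⌈_/2⌉) renaming (_*_ to _*ℕ_)
import Data.Nat.Properties as ℕ
open import Data.Product using (_×_; _,_)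
open import Data.Sum using (_⊎_; inj₁; inj₂)
open import Data.Unit using (tt)
open import Data.Vec using ([]; _∷_; head)
open import Data.Vec.Relation.Binary.Pointwise.Inductive as Pointwise
  using (Pointwise; []; _∷_; Pointwise-≡⇒≡)
open import Function using (_∘_; _⇔_; mk⇔; Equivalence)
open import Relation.Nullary using (Dec; yes; no; ¬_)
open import Relation.Nullary.Decidable using (_×-dec_)
open import Relation.Binary.PropositionalEquality
  using (refl; sym; trans; cong; cong₂; subst; module ≡-Reasoning)

open Equivalence using (to; from)

private
  variable
    A B : Set
    k : ℕ

sumℤ-++ : (xs ys : List ℤ) → sumℤ (xs ++ ys) ≡ sumℤ xs + sumℤ ys
sumℤ-++ []       ys = sym (ℤ.+-identityˡ _)
sumℤ-++ (x ∷ xs) ys = trans (cong (x +_) (sumℤ-++ xs ys)) (sym (ℤ.+-assoc x _ _))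

sumℤ-map-+ : (f g : A → ℤ) (xs : List A) →
  sumℤ (map (λ x → f x + g x) xs) ≡ sumℤ (map f xs) + sumℤ (map g xs)
sumℤ-map-+ f g []       = refl
sumℤ-map-+ f g (x ∷ xs) =
  trans (cong (f x + g x +_) (sumℤ-map-+ f g xs)) (+-interchange (f x) (g x) _ _)

sumℤ-map-*ʳ : (f : A → ℤ) (c : ℤ) (xs : List A) →
  sumℤ (map (λ x → f x * c) xs) ≡ sumℤ (map f xs) * c
sumℤ-map-*ʳ f c []       = sym (ℤ.*-zeroˡ c)
sumℤ-map-*ʳ f c (x ∷ xs) =
  trans (cong (f x * c +_) (sumℤ-map-*ʳ f c xs)) (sym (ℤ.*-distribʳ-+ c (f x) _))

sumℤ-map-neg : (f : A → ℤ) (xs : List A) → sumℤ (map (λ x → - f x) xs) ≡ - sumℤ (map f xs)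
sumℤ-map-neg f []       = refl
sumℤ-map-neg f (x ∷ xs) =
  trans (cong (- f x +_) (sumℤ-map-neg f xs)) (sym (ℤ.neg-distrib-+ (f x) _))

sumℤ-map-0 : (xs : List A) → sumℤ (map (λ _ → 0ℤ) xs) ≡ 0ℤ
sumℤ-map-0 []       = refl
sumℤ-map-0 (x ∷ xs) = trans (ℤ.+-identityˡ _) (sumℤ-map-0 xs)

𝟙 : {P : Set} → Dec P → ℤ
𝟙 (yes _) = 1ℤ
𝟙 (no _)  = 0ℤ

sumℤ-map-filter : {P : A → Set} (P? : ∀ x → Dec (P x)) (g : A → ℤ) (xs : List A) →
  sumℤ (map g (filter P? xs)) ≡ sumℤ (map (λ x → 𝟙 (P? x) * g x) xs)
sumℤ-map-filter P? g []       = refl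
sumℤ-map-filter P? g (x ∷ xs) with P? x
... | yes _ = cong₂ _+_ (sym (ℤ.*-identityˡ (g x))) (sumℤ-map-filter P? g xs)
... | no _  = trans (sumℤ-map-filter P? g xs)
  (sym (trans (cong (_+ rest) (ℤ.*-zeroˡ (g x))) (ℤ.+-identityˡ rest)))
  where rest = sumℤ (map (λ x → 𝟙 (P? x) * g x) xs)

𝟙-cong : {P Q : Set} → P ⇔ Q → (p : Dec P) (q : Dec Q) → 𝟙 p ≡ 𝟙 q
𝟙-cong P⇔Q (yes _) (yes _) = refl
𝟙-cong P⇔Q (yes p) (no ¬q) = ⊥-elim (¬q (to P⇔Q p))
𝟙-cong P⇔Q (no ¬p) (yes q) = ⊥-elim (¬p (from P⇔Q q))
𝟙-cong P⇔Q (no _)  (no _)  = refl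

𝟙-×-dec : {P Q : Set} (p : Dec P) (q : Dec Q) → 𝟙 (p ×-dec q) ≡ 𝟙 p * 𝟙 q
𝟙-×-dec (yes _) (yes _) = refl
𝟙-×-dec (yes _) (no _)  = refl
𝟙-×-dec (no _)  _       = refl

sgn : List A → ℤ
sgn s = -1ℤ ^ length s

sgn-++ : (s t : List A) → sgn (s ++ t) ≡ sgn s * sgn t
sgn-++ s t = trans (cong (-1ℤ ^_) (List.length-++ s)) (ℤ.^-distribˡ-+-* -1ℤ (length s) (length t))

sgn-map : (f : A → B) (s : List A) → sgn (map f s) ≡ sgn s
sgn-map f s = cong (-1ℤ ^_) (List.length-map f s)

sgn-insert : (s : List A) (x : A) (u : List A) → sgn (s ++ x ∷ u) ≡ - sgn (s ++ u)
sgn-insert s x u =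
  trans (cong (-1ℤ ^_) (List.length-++-sucʳ s x u)) (ℤ.-1*i≡-i (sgn (s ++ u)))

∑⊆ : List A → (List A → ℤ) → ℤ
∑⊆ xs f = sumℤ (map f (subsets xs))

infix 5 ∑⊆
syntax ∑⊆ xs (λ s → e) = ∑[ s ⊆ xs ] e

∑⊆-∷ : (x : A) (xs : List A) (f : List A → ℤ) →
  ∑[ s ⊆ x ∷ xs ] f s ≡ (∑[ s ⊆ xs ] f s) + (∑[ s ⊆ xs ] f (x ∷ s))
∑⊆-∷ x xs f = begin
  sumℤ (map f (subsets xs ++ map (x ∷_) (subsets xs)))
    ≡⟨ cong sumℤ (List.map-++ f (subsets xs) _) ⟩
  sumℤ (map f (subsets xs) ++ map f (map (x ∷_) (subsets xs)))
    ≡⟨ sumℤ-++ (map f (subsets xs)) _ ⟩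
  ∑⊆ xs f + sumℤ (map f (map (x ∷_) (subsets xs)))
    ≡⟨ cong (λ l → ∑⊆ xs f + sumℤ l) (List.map-∘ (subsets xs)) ⟨
  ∑⊆ xs f + ∑⊆ xs (f ∘ (x ∷_)) ∎
  where open ≡-Reasoning

∑⊆-cong : (xs : List A) {f g : List A → ℤ} → (∀ s → s ⊆ xs → f s ≡ g s) →
  ∑[ s ⊆ xs ] f s ≡ ∑[ s ⊆ xs ] g s
∑⊆-cong []       f≗g = cong (_+ 0ℤ) (f≗g [] (λ ()))
∑⊆-cong (x ∷ xs) {f} {g} f≗g = begin
  ∑⊆ (x ∷ xs) f
    ≡⟨ ∑⊆-∷ x xs f ⟩
  ∑⊆ xs f + ∑⊆ xs (f ∘ (x ∷_))
    ≡⟨ cong₂ _+_ (∑⊆-cong xs (λ s s⊆xs → f≗g s (there ∘ s⊆xs)))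
                 (∑⊆-cong xs (λ s s⊆xs → f≗g (x ∷ s) (∷-mono s⊆xs))) ⟩
  ∑⊆ xs g + ∑⊆ xs (g ∘ (x ∷_))
    ≡⟨ ∑⊆-∷ x xs g ⟨
  ∑⊆ (x ∷ xs) g ∎
  where
  open ≡-Reasoning
  ∷-mono : ∀ {s} → s ⊆ xs → x ∷ s ⊆ x ∷ xs
  ∷-mono s⊆xs (here refl) = here refl
  ∷-mono s⊆xs (there y∈s) = there (s⊆xs y∈s)

∑⊆-++ : (xs ys : List A) (f : List A → ℤ) →
  ∑[ s ⊆ xs ++ ys ] f s ≡ ∑[ s ⊆ xs ] ∑[ t ⊆ ys ] f (s ++ t)
∑⊆-++ []       ys f = sym (ℤ.+-identityʳ _)
∑⊆-++ (x ∷ xs) ys f = begin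
  ∑⊆ (x ∷ xs ++ ys) f
    ≡⟨ ∑⊆-∷ x (xs ++ ys) f ⟩
  ∑⊆ (xs ++ ys) f + ∑⊆ (xs ++ ys) (f ∘ (x ∷_))
    ≡⟨ cong₂ _+_ (∑⊆-++ xs ys f) (∑⊆-++ xs ys (f ∘ (x ∷_))) ⟩
  ∑⊆ xs (λ s → ∑⊆ ys (λ t → f (s ++ t))) + ∑⊆ xs (λ s → ∑⊆ ys (λ t → f (x ∷ s ++ t)))
    ≡⟨ ∑⊆-∷ x xs (λ s → ∑⊆ ys (λ t → f (s ++ t))) ⟨
  ∑⊆ (x ∷ xs) (λ s → ∑⊆ ys (λ t → f (s ++ t))) ∎
  where open ≡-Reasoning

∑⊆-map : (g : A → B) (xs : List A) (f : List B → ℤ) →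
  ∑[ s ⊆ map g xs ] f s ≡ ∑[ s ⊆ xs ] f (map g s)
∑⊆-map g []       f = refl
∑⊆-map g (x ∷ xs) f = begin
  ∑⊆ (g x ∷ map g xs) f
    ≡⟨ ∑⊆-∷ (g x) (map g xs) f ⟩
  ∑⊆ (map g xs) f + ∑⊆ (map g xs) (f ∘ (g x ∷_))
    ≡⟨ cong₂ _+_ (∑⊆-map g xs f) (∑⊆-map g xs (f ∘ (g x ∷_))) ⟩
  ∑⊆ xs (f ∘ map g) + ∑⊆ xs (λ s → f (g x ∷ map g s))
    ≡⟨ ∑⊆-∷ x xs (f ∘ map g) ⟨
  ∑⊆ (x ∷ xs) (f ∘ map g) ∎
  where open ≡-Reasoning

∑⊆-*ʳ : (xs : List A) (f : List A → ℤ) (c : ℤ) →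
  ∑[ s ⊆ xs ] f s * c ≡ (∑[ s ⊆ xs ] f s) * c
∑⊆-*ʳ xs f c = sumℤ-map-*ʳ f c (subsets xs)

∑⊆-*ˡ : (xs : List A) (c : ℤ) (f : List A → ℤ) →
  ∑[ s ⊆ xs ] c * f s ≡ c * (∑[ s ⊆ xs ] f s)
∑⊆-*ˡ xs c f = trans (∑⊆-cong xs (λ s _ → ℤ.*-comm c (f s))) (trans (∑⊆-*ʳ xs f c) (ℤ.*-comm _ c))

∑⊆-swap : (xs : List A) (ys : List B) (g : List A → List B → ℤ) →
  ∑[ s ⊆ xs ] ∑[ t ⊆ ys ] g s t ≡ ∑[ t ⊆ ys ] ∑[ s ⊆ xs ] g s t
∑⊆-swap []       ys g =
  trans (ℤ.+-identityʳ _) (∑⊆-cong ys (λ t _ → sym (ℤ.+-identityʳ (g [] t))))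
∑⊆-swap (x ∷ xs) ys g = begin
  ∑⊆ (x ∷ xs) (λ s → ∑⊆ ys (g s))
    ≡⟨ ∑⊆-∷ x xs (λ s → ∑⊆ ys (g s)) ⟩
  ∑⊆ xs (λ s → ∑⊆ ys (g s)) + ∑⊆ xs (λ s → ∑⊆ ys (g (x ∷ s)))
    ≡⟨ cong₂ _+_ (∑⊆-swap xs ys g) (∑⊆-swap xs ys (g ∘ (x ∷_))) ⟩
  ∑⊆ ys (λ t → ∑⊆ xs (λ s → g s t)) + ∑⊆ ys (λ t → ∑⊆ xs (λ s → g (x ∷ s) t))
    ≡⟨ sumℤ-map-+ (λ t → ∑⊆ xs (λ s → g s t)) (λ t → ∑⊆ xs (λ s → g (x ∷ s) t)) (subsets ys) ⟨
  ∑⊆ ys (λ t → ∑⊆ xs (λ s → g s t) + ∑⊆ xs (λ s → g (x ∷ s) t))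
    ≡⟨ ∑⊆-cong ys (λ t _ → ∑⊆-∷ x xs (λ s → g s t)) ⟨
  ∑⊆ ys (λ t → ∑⊆ (x ∷ xs) (λ s → g s t)) ∎
  where open ≡-Reasoning

∑⊆-concentrated : (xs : List A) (f : List A → ℤ) →
  (∀ y s → y ∷ s ⊆ xs → f (y ∷ s) ≡ 0ℤ) → ∑[ s ⊆ xs ] f s ≡ f []
∑⊆-concentrated []       f f-vanishes = ℤ.+-identityʳ (f [])
∑⊆-concentrated (x ∷ xs) f f-vanishes = begin
  ∑⊆ (x ∷ xs) f
    ≡⟨ ∑⊆-∷ x xs f ⟩
  ∑⊆ xs f + ∑⊆ xs (f ∘ (x ∷_))
    ≡⟨ cong₂ _+_ (∑⊆-concentrated xs f (λ y s ys⊆xs → f-vanishes y s (there ∘ ys⊆xs)))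
                 (∑⊆-cong xs (λ s s⊆xs → f-vanishes x s (∈-∷⁺ʳ (here refl) (there ∘ s⊆xs)))) ⟩
  f [] + sumℤ (map (λ _ → 0ℤ) (subsets xs))
    ≡⟨ cong (f [] +_) (sumℤ-map-0 (subsets xs)) ⟩
  f [] + 0ℤ
    ≡⟨ ℤ.+-identityʳ (f []) ⟩
  f [] ∎
  where open ≡-Reasoning

∑⊆-toggle : (ys : List A) (x : A) (zs : List A) (f : List A → ℤ) →
  (∀ s u → f (s ++ x ∷ u) ≡ - f (s ++ u)) → ∑[ s ⊆ ys ++ x ∷ zs ] f s ≡ 0ℤ
∑⊆-toggle []       x zs f toggle = begin
  ∑⊆ (x ∷ zs) f
    ≡⟨ ∑⊆-∷ x zs f ⟩
  ∑⊆ zs f + ∑⊆ zs (f ∘ (x ∷_))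
    ≡⟨ cong (∑⊆ zs f +_) (∑⊆-cong zs (λ u _ → toggle [] u)) ⟩
  ∑⊆ zs f + ∑⊆ zs (λ u → - f u)
    ≡⟨ cong (∑⊆ zs f +_) (sumℤ-map-neg f (subsets zs)) ⟩
  ∑⊆ zs f + - ∑⊆ zs f
    ≡⟨ ℤ.+-inverseʳ (∑⊆ zs f) ⟩
  0ℤ ∎
  where open ≡-Reasoning
∑⊆-toggle (y ∷ ys) x zs f toggle = begin
  ∑⊆ (y ∷ ys ++ x ∷ zs) f
    ≡⟨ ∑⊆-∷ y (ys ++ x ∷ zs) f ⟩
  ∑⊆ (ys ++ x ∷ zs) f + ∑⊆ (ys ++ x ∷ zs) (f ∘ (y ∷_))
    ≡⟨ cong₂ _+_ (∑⊆-toggle ys x zs f toggle)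
                 (∑⊆-toggle ys x zs (f ∘ (y ∷_)) (λ s u → toggle (y ∷ s) u)) ⟩
  0ℤ ∎
  where open ≡-Reasoning

Near : ℕ → ℕ → Set
Near a b = ∣ a - b ∣ ≤ 1

Near-refl : (a : ℕ) → Near a a
Near-refl a = ℕ.≤-trans (ℕ.≤-reflexive (ℕ.∣n-n∣≡0 a)) z≤n

Near-suc : (a : ℕ) → Near a (suc a)
Near-suc zero    = ℕ.≤-refl
Near-suc (suc a) = Near-suc a

Near-sym : {a b : ℕ} → Near a b → Near b a
Near-sym {a} {b} = subst (_≤ 1) (ℕ.∣-∣-comm a b)

Near⇒≤suc : {a b : ℕ} → Near a b → b ≤ suc a
Near⇒≤suc {a} {b} near =
  ℕ.≤-trans (ℕ.m≤n+∣n-m∣ b a) (ℕ.≤-trans (ℕ.+-monoʳ-≤ a near) (ℕ.≤-reflexive (ℕ.+-comm a 1)))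

¬Near-above : {a b : ℕ} → suc a < b → ¬ Near a b
¬Near-above a<b = ℕ.<⇒≱ a<b ∘ Near⇒≤suc

Close : Vec ℕ k → Vec ℕ k → Set
Close = Pointwise Near

maxDist≤⇔Pointwise : (d : ℕ) (u v : Vec ℕ k) →
  maxDist u v ≤ d ⇔ Pointwise (λ a b → ∣ a - b ∣ ≤ d) u v
maxDist≤⇔Pointwise d u v = mk⇔ (bounded u v) (maxDist≤ u v)
  where
  bounded : (u v : Vec ℕ k) → maxDist u v ≤ d → Pointwise (λ a b → ∣ a - b ∣ ≤ d) u v
  bounded []      []      _ = []
  bounded (a ∷ u) (b ∷ v) p = ℕ.m⊔n≤o⇒m≤o _ _ p ∷ bounded u v (ℕ.m⊔n≤o⇒n≤o _ _ p)
  maxDist≤ : (u v : Vec ℕ k) → Pointwise (λ a b → ∣ a - b ∣ ≤ d) u v → maxDist u v ≤ d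
  maxDist≤ []      []      []       = z≤n
  maxDist≤ (a ∷ u) (b ∷ v) (p ∷ ps) = ℕ.⊔-lub p (maxDist≤ u v ps)

maxDist≡0⇒≡ : (u v : Vec ℕ k) → maxDist u v ≡ 0 → u ≡ v
maxDist≡0⇒≡ u v eq = Pointwise-≡⇒≡ (Pointwise.map (ℕ.∣m-n∣≡0⇒m≡n ∘ ℕ.n≤0⇒n≡0)
  (to (maxDist≤⇔Pointwise 0 u v) (ℕ.≤-reflexive eq)))

equalOrAdjacent⇔Close : (u v : Vec ℕ k) → (u ≡ v ⊎ T (maxDist u v ≡ᵇ 1)) ⇔ Close u v
equalOrAdjacent⇔Close u v = mk⇔ close equalOrAdjacent
  where
  close : u ≡ v ⊎ T (maxDist u v ≡ᵇ 1) → Close u v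
  close (inj₁ refl) = Pointwise.refl (λ {a} → Near-refl a)
  close (inj₂ adj)  = to (maxDist≤⇔Pointwise 1 u v) (ℕ.≤-reflexive (ℕ.≡ᵇ⇒≡ _ 1 adj))
  equalOrAdjacent : Close u v → u ≡ v ⊎ T (maxDist u v ≡ᵇ 1)
  equalOrAdjacent c with maxDist u v in eq | from (maxDist≤⇔Pointwise 1 u v) c
  ... | zero        | _      = inj₁ (maxDist≡0⇒≡ u v eq)
  ... | suc zero    | _      = inj₂ tt
  ... | suc (suc _) | s≤s ()

-- Domination by closed neighbourhoods; S need not be drawn from V.
Dominates : List (Vec ℕ k) → List (Vec ℕ k) → Set
Dominates S V = All (λ v → Any (Close v) S) V

dominates? : (S V : List (Vec ℕ k)) → Dec (Dominates S V)
dominates? S V = all? (λ v → any? (Pointwise.decidable (λ a b → ∣ a - b ∣ ≤? 1) v) S) V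

Dominates-resp-⊆ : {S S′ V : List (Vec ℕ k)} → S ⊆ S′ → Dominates S V → Dominates S′ V
Dominates-resp-⊆ S⊆S′ = All.map (Any-resp-⊆ S⊆S′)

Dominating⇔Dominates : (n : Vec ℕ k) (S : List (Vec ℕ k)) →
  FinGraph.Dominating (kingGraph n) S ⇔ Dominates S (kingVertices n)
Dominating⇔Dominates n S = mk⇔ (All.map (λ {v} → dominated v)) (All.map (λ {v} → dominatedBy v))
  where
  dominated : ∀ v → FinGraph.DominatedBy (kingGraph n) S v → Any (Close v) S
  dominated v = Any.map (to (equalOrAdjacent⇔Close v _)) ∘ Any.Any-⊎⁺
  dominatedBy : ∀ v → Any (Close v) S → FinGraph.DominatedBy (kingGraph n) S v
  dominatedBy v = Any.Any-⊎⁻ ∘ Any.map (from (equalOrAdjacent⇔Close v _))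

weight : List (Vec ℕ k) → List (Vec ℕ k) → ℤ
weight V S = 𝟙 (dominates? S V) * sgn S

P₋₁ : List (Vec ℕ k) → ℤ
P₋₁ V = ∑[ S ⊆ V ] weight V S

dominationPolyAt-kingGraph : (n : Vec ℕ k) →
  dominationPolyAt (kingGraph n) -1ℤ ≡ P₋₁ (kingVertices n)
dominationPolyAt-kingGraph {k} n =
  trans (sumℤ-map-filter dominating? sgn (subsets V))
        (∑⊆-cong V (λ S _ → cong (_* sgn S)
           (𝟙-cong (Dominating⇔Dominates n S) (dominating? S) (dominates? S V))))
  where
  open FinGraph (kingGraph n) using (dominating?)
  V : List (Vec ℕ k)
  V = kingVertices n

weight-insert : (V : List (Vec ℕ k)) {x : Vec ℕ k} {t : List (Vec ℕ k)} → x ∈ t →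
  (s u : List (Vec ℕ k)) → weight V ((s ++ x ∷ u) ++ t) ≡ - weight V ((s ++ u) ++ t)
weight-insert V {x} {t} x∈t s u = begin
  𝟙 (dominates? ((s ++ x ∷ u) ++ t) V) * sgn ((s ++ x ∷ u) ++ t)
    ≡⟨ cong₂ _*_ (𝟙-cong (mk⇔ (Dominates-resp-⊆ dropX) (Dominates-resp-⊆ addX))
                         (dominates? ((s ++ x ∷ u) ++ t) V) (dominates? ((s ++ u) ++ t) V))
                 sgn-flip ⟩
  𝟙 (dominates? ((s ++ u) ++ t) V) * - sgn ((s ++ u) ++ t)
    ≡⟨ ℤ.neg-distribʳ-* (𝟙 (dominates? ((s ++ u) ++ t) V)) (sgn ((s ++ u) ++ t)) ⟨
  - weight V ((s ++ u) ++ t) ∎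
  where
  open ≡-Reasoning
  dropX : (s ++ x ∷ u) ++ t ⊆ (s ++ u) ++ t
  dropX = ⊆-trans (++⁺ˡ t (⊆-reflexive-↭ (shift x s u))) (∈-∷⁺ʳ (∈-++⁺ʳ (s ++ u) x∈t) ⊆-refl)
  addX : (s ++ u) ++ t ⊆ (s ++ x ∷ u) ++ t
  addX = ++⁺ˡ t (++⁺ʳ s (xs⊆x∷xs u x))
  sgn-flip : sgn ((s ++ x ∷ u) ++ t) ≡ - sgn ((s ++ u) ++ t)
  sgn-flip = begin
    sgn ((s ++ x ∷ u) ++ t) ≡⟨ cong sgn (List.++-assoc s (x ∷ u) t) ⟩
    sgn (s ++ x ∷ u ++ t)   ≡⟨ sgn-insert s x (u ++ t) ⟩
    - sgn (s ++ u ++ t)     ≡⟨ cong (-_ ∘ sgn) (List.++-assoc s u t) ⟨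
    - sgn ((s ++ u) ++ t)   ∎

∑⊆-weight-++-∷ : (V : List (Vec ℕ k)) (x : Vec ℕ k) (t : List (Vec ℕ k)) → x ∈ V →
  ∑[ s ⊆ V ] weight V (s ++ x ∷ t) ≡ 0ℤ
∑⊆-weight-++-∷ V x t x∈V with ∈-∃++ x∈V
... | ys , zs , refl = ∑⊆-toggle ys x zs (λ s → weight V (s ++ x ∷ t)) (weight-insert V (here refl))

layer : ℕ → List (Vec ℕ k) → List (Vec ℕ (suc k))
layer a = map (a ∷_)

stack : List ℕ → List (Vec ℕ k) → List (Vec ℕ (suc k))
stack as H = concatMap (λ a → layer a H) as

Above : ℕ → Vec ℕ (suc k) → Set
Above a v = a < head v

Any-layer⁺ : {a b : ℕ} {w : Vec ℕ k} {t : List (Vec ℕ k)} →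
  Near b a → Any (Close w) t → Any (Close (b ∷ w)) (layer a t)
Any-layer⁺ near = Any.map⁺ ∘ Any.map (near ∷_)

Any-layer⁻ : {a b : ℕ} {w : Vec ℕ k} {t : List (Vec ℕ k)} →
  Any (Close (b ∷ w)) (layer a t) → Any (Close w) t
Any-layer⁻ = Any.map (λ { (_ ∷ close) → close }) ∘ Any.map⁻

¬Close-above : {a : ℕ} {w : Vec ℕ k} {v : Vec ℕ (suc k)} → Above (suc a) v → ¬ Close (a ∷ w) v
¬Close-above {v = h ∷ _} above (near ∷ _) = ¬Near-above above near

¬Any-above : {a : ℕ} {w : Vec ℕ k} {r : List (Vec ℕ (suc k))} →
  All (Above (suc a)) r → ¬ Any (Close (a ∷ w)) r
¬Any-above r-above i with All.lookupAny r-above i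
... | above , close = ¬Close-above above close

¬Any-layer-below : {a : ℕ} {v : Vec ℕ (suc k)} {t : List (Vec ℕ k)} →
  Above (suc a) v → ¬ Any (Close v) (layer a t)
¬Any-layer-below above i with Any.satisfied (Any.map⁻ i)
... | _ , close = ¬Close-above above (Pointwise.sym (λ {a} {b} → Near-sym {a} {b}) close)

Dominates-layer : (a : ℕ) {t H : List (Vec ℕ k)} → Dominates (layer a t) (layer a H) ⇔ Dominates t H
Dominates-layer a = mk⇔ (All.map Any-layer⁻ ∘ All.map⁻) (All.map⁺ ∘ All.map (Any-layer⁺ (Near-refl a)))

P₋₁-layer : (a : ℕ) (H : List (Vec ℕ k)) → P₋₁ (layer a H) ≡ P₋₁ H
P₋₁-layer a H = trans (∑⊆-map (a ∷_) H (weight (layer a H)))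
  (∑⊆-cong H (λ t _ → cong₂ _*_
    (𝟙-cong (Dominates-layer a) (dominates? (layer a t) (layer a H)) (dominates? t H))
    (sgn-map (a ∷_) t)))

module _ {a : ℕ} {t₁ t₂ : List (Vec ℕ k)} {r : List (Vec ℕ (suc k))} where

  lowerRow⁻ : All (Above (suc a)) r → {w : Vec ℕ k} →
    Any (Close (a ∷ w)) (layer a t₁ ++ layer (suc a) t₂ ++ r) → Any (Close w) (t₁ ++ t₂)
  lowerRow⁻ r-above i with Any.++⁻ (layer a t₁) i
  ... | inj₁ i₁ = Any.++⁺ˡ (Any-layer⁻ i₁)
  ... | inj₂ i₂ with Any.++⁻ (layer (suc a) t₂) i₂
  ...   | inj₁ i₃ = Any.++⁺ʳ t₁ (Any-layer⁻ i₃)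
  ...   | inj₂ i₄ = ⊥-elim (¬Any-above r-above i₄)

  lowerRow⁺ : {b : ℕ} → Near b a → Near b (suc a) → {w : Vec ℕ k} →
    Any (Close w) (t₁ ++ t₂) → Any (Close (b ∷ w)) (layer a t₁ ++ layer (suc a) t₂ ++ r)
  lowerRow⁺ near near′ i with Any.++⁻ t₁ i
  ... | inj₁ i₁ = Any.++⁺ˡ (Any-layer⁺ near i₁)
  ... | inj₂ i₂ = Any.++⁺ʳ (layer a t₁) (Any.++⁺ˡ (Any-layer⁺ near′ i₂))

  upperRow⁻ : {v : Vec ℕ (suc k)} → Above (suc a) v →
    Any (Close v) (layer a t₁ ++ layer (suc a) t₂ ++ r) → Any (Close v) (layer (suc a) t₂ ++ r)
  upperRow⁻ above i with Any.++⁻ (layer a t₁) i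
  ... | inj₁ i₁ = ⊥-elim (¬Any-layer-below above i₁)
  ... | inj₂ i₂ = i₂

  -- Layer a+1 imposes no condition of its own: it is dominated by whatever
  -- dominates layer a from inside t₁ ∪ t₂.
  Dominates-twoLayers : {H : List (Vec ℕ k)} {R : List (Vec ℕ (suc k))} →
    All (Above (suc a)) R → All (Above (suc a)) r →
    Dominates (layer a t₁ ++ layer (suc a) t₂ ++ r) (layer a H ++ layer (suc a) H ++ R)
      ⇔ (Dominates (t₁ ++ t₂) H × Dominates (layer (suc a) t₂ ++ r) R)
  Dominates-twoLayers {H} {R} R-above r-above = mk⇔ split join
    where
    split : Dominates (layer a t₁ ++ layer (suc a) t₂ ++ r) (layer a H ++ layer (suc a) H ++ R) →
            Dominates (t₁ ++ t₂) H × Dominates (layer (suc a) t₂ ++ r) R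
    split d = All.map (lowerRow⁻ r-above) (All.map⁻ (All.++⁻ˡ (layer a H) d))
            , All.zipWith (λ (above , i) → upperRow⁻ above i)
                          (R-above , All.++⁻ʳ (layer (suc a) H) (All.++⁻ʳ (layer a H) d))
    join : Dominates (t₁ ++ t₂) H × Dominates (layer (suc a) t₂ ++ r) R →
           Dominates (layer a t₁ ++ layer (suc a) t₂ ++ r) (layer a H ++ layer (suc a) H ++ R)
    join (dH , dR) =
      All.++⁺ (All.map⁺ (All.map (lowerRow⁺ (Near-refl a) (Near-suc a)) dH))
      (All.++⁺ (All.map⁺ (All.map (lowerRow⁺ (Near-sym {a} (Near-suc a)) (Near-refl (suc a))) dH))
               (All.map (Any.++⁺ʳ (layer a t₁)) dR))

∑⊆-twoLayers : (a : ℕ) (H : List (Vec ℕ k)) (R : List (Vec ℕ (suc k))) (f : List (Vec ℕ (suc k)) → ℤ) →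
  ∑[ S ⊆ layer a H ++ layer (suc a) H ++ R ] f S
    ≡ ∑[ t₁ ⊆ H ] ∑[ t₂ ⊆ H ] ∑[ r ⊆ R ] f (layer a t₁ ++ layer (suc a) t₂ ++ r)
∑⊆-twoLayers a H R f = begin
  ∑⊆ (layer a H ++ layer (suc a) H ++ R) f
    ≡⟨ ∑⊆-++ (layer a H) _ f ⟩
  ∑⊆ (layer a H) (λ s₁ → ∑⊆ (layer (suc a) H ++ R) (λ s → f (s₁ ++ s)))
    ≡⟨ ∑⊆-cong (layer a H) (λ s₁ _ → ∑⊆-++ (layer (suc a) H) R (λ s → f (s₁ ++ s))) ⟩
  ∑⊆ (layer a H) (λ s₁ → ∑⊆ (layer (suc a) H) (λ s₂ → ∑⊆ R (λ r → f (s₁ ++ s₂ ++ r))))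
    ≡⟨ ∑⊆-map (a ∷_) H _ ⟩
  ∑⊆ H (λ t₁ → ∑⊆ (layer (suc a) H) (λ s₂ → ∑⊆ R (λ r → f (layer a t₁ ++ s₂ ++ r))))
    ≡⟨ ∑⊆-cong H (λ t₁ _ → ∑⊆-map (suc a ∷_) H _) ⟩
  ∑⊆ H (λ t₁ → ∑⊆ H (λ t₂ → ∑⊆ R (λ r → f (layer a t₁ ++ layer (suc a) t₂ ++ r)))) ∎
  where open ≡-Reasoning

sgn-twoLayers : (a : ℕ) (t₁ t₂ : List (Vec ℕ k)) (r : List (Vec ℕ (suc k))) →
  sgn (layer a t₁ ++ layer (suc a) t₂ ++ r) ≡ sgn (t₁ ++ t₂) * sgn r
sgn-twoLayers a t₁ t₂ r = begin
  sgn (layer a t₁ ++ layer (suc a) t₂ ++ r)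
    ≡⟨ cong sgn (List.++-assoc (layer a t₁) _ r) ⟨
  sgn ((layer a t₁ ++ layer (suc a) t₂) ++ r)
    ≡⟨ sgn-++ (layer a t₁ ++ layer (suc a) t₂) r ⟩
  sgn (layer a t₁ ++ layer (suc a) t₂) * sgn r
    ≡⟨ cong (_* sgn r) (sgn-++ (layer a t₁) (layer (suc a) t₂)) ⟩
  sgn (layer a t₁) * sgn (layer (suc a) t₂) * sgn r
    ≡⟨ cong (_* sgn r) (cong₂ _*_ (sgn-map (a ∷_) t₁) (sgn-map (suc a ∷_) t₂)) ⟩
  sgn t₁ * sgn t₂ * sgn r
    ≡⟨ cong (_* sgn r) (sgn-++ t₁ t₂) ⟨
  sgn (t₁ ++ t₂) * sgn r ∎
  where open ≡-Reasoning

weight-twoLayers : {a : ℕ} {H t₁ t₂ : List (Vec ℕ k)} {R r : List (Vec ℕ (suc k))} →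
  All (Above (suc a)) R → All (Above (suc a)) r →
  weight (layer a H ++ layer (suc a) H ++ R) (layer a t₁ ++ layer (suc a) t₂ ++ r)
    ≡ weight H (t₁ ++ t₂) * (𝟙 (dominates? (layer (suc a) t₂ ++ r) R) * sgn r)
weight-twoLayers {k = k} {a = a} {H} {t₁} {t₂} {R} {r} R-above r-above = begin
  𝟙 (dominates? (layer a t₁ ++ layer (suc a) t₂ ++ r) (layer a H ++ layer (suc a) H ++ R))
    * sgn (layer a t₁ ++ layer (suc a) t₂ ++ r)
    ≡⟨ cong₂ _*_ (𝟙-cong (Dominates-twoLayers R-above r-above) (dominates? _ _) (lower ×-dec upper))
                 (sgn-twoLayers a t₁ t₂ r) ⟩
  𝟙 (lower ×-dec upper) * (sgn (t₁ ++ t₂) * sgn r)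
    ≡⟨ cong (_* (sgn (t₁ ++ t₂) * sgn r)) (𝟙-×-dec lower upper) ⟩
  𝟙 lower * 𝟙 upper * (sgn (t₁ ++ t₂) * sgn r)
    ≡⟨ *-interchange (𝟙 lower) (𝟙 upper) (sgn (t₁ ++ t₂)) (sgn r) ⟩
  𝟙 lower * sgn (t₁ ++ t₂) * (𝟙 upper * sgn r) ∎
  where
  open ≡-Reasoning
  lower : Dec (Dominates (t₁ ++ t₂) H)
  lower = dominates? (t₁ ++ t₂) H
  upper : Dec (Dominates (layer (suc a) t₂ ++ r) R)
  upper = dominates? (layer (suc a) t₂ ++ r) R

∑⊆-weight-absorb : (H : List (Vec ℕ k)) (g : List (Vec ℕ k) → ℤ) →
  ∑[ t₂ ⊆ H ] (∑[ t₁ ⊆ H ] weight H (t₁ ++ t₂)) * g t₂ ≡ P₋₁ H * g []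
∑⊆-weight-absorb H g = begin
  ∑⊆ H (λ t₂ → ∑⊆ H (λ t₁ → weight H (t₁ ++ t₂)) * g t₂)
    ≡⟨ ∑⊆-concentrated H _ (λ x t x∷t⊆H →
         trans (cong (_* g (x ∷ t)) (∑⊆-weight-++-∷ H x t (x∷t⊆H (here refl)))) (ℤ.*-zeroˡ (g (x ∷ t)))) ⟩
  ∑⊆ H (λ t₁ → weight H (t₁ ++ [])) * g []
    ≡⟨ cong (_* g []) (∑⊆-cong H (λ t₁ _ → cong (weight H) (List.++-identityʳ t₁))) ⟩
  P₋₁ H * g [] ∎
  where open ≡-Reasoning

P₋₁-twoLayers : (a : ℕ) (H : List (Vec ℕ k)) {R : List (Vec ℕ (suc k))} → All (Above (suc a)) R →
  P₋₁ (layer a H ++ layer (suc a) H ++ R) ≡ P₋₁ H * P₋₁ R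
P₋₁-twoLayers {k = k} a H {R} R-above = begin
  P₋₁ V
    ≡⟨ ∑⊆-twoLayers a H R (weight V) ⟩
  ∑⊆ H (λ t₁ → ∑⊆ H (λ t₂ → ∑⊆ R (λ r → weight V (layer a t₁ ++ layer (suc a) t₂ ++ r))))
    ≡⟨ ∑⊆-cong H (λ t₁ _ → ∑⊆-cong H (λ t₂ _ → ∑⊆-cong R (λ r r⊆R →
         weight-twoLayers {H = H} {t₁} {t₂} R-above (All.anti-mono r⊆R R-above)))) ⟩
  ∑⊆ H (λ t₁ → ∑⊆ H (λ t₂ → ∑⊆ R (λ r → weight H (t₁ ++ t₂) * upper t₂ r)))
    ≡⟨ ∑⊆-cong H (λ t₁ _ → ∑⊆-cong H (λ t₂ _ → ∑⊆-*ˡ R (weight H (t₁ ++ t₂)) (upper t₂))) ⟩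
  ∑⊆ H (λ t₁ → ∑⊆ H (λ t₂ → weight H (t₁ ++ t₂) * ∑⊆ R (upper t₂)))
    ≡⟨ ∑⊆-swap H H _ ⟩
  ∑⊆ H (λ t₂ → ∑⊆ H (λ t₁ → weight H (t₁ ++ t₂) * ∑⊆ R (upper t₂)))
    ≡⟨ ∑⊆-cong H (λ t₂ _ → ∑⊆-*ʳ H (λ t₁ → weight H (t₁ ++ t₂)) (∑⊆ R (upper t₂))) ⟩
  ∑⊆ H (λ t₂ → ∑⊆ H (λ t₁ → weight H (t₁ ++ t₂)) * ∑⊆ R (upper t₂))
    ≡⟨ ∑⊆-weight-absorb H (∑⊆ R ∘ upper) ⟩
  P₋₁ H * P₋₁ R ∎
  where
  open ≡-Reasoning
  V : List (Vec ℕ (suc k))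
  V = layer a H ++ layer (suc a) H ++ R
  upper : List (Vec ℕ k) → List (Vec ℕ (suc k)) → ℤ
  upper t₂ r = 𝟙 (dominates? (layer (suc a) t₂ ++ r) R) * sgn r

consecutive : ℕ → ℕ → List ℕ
consecutive c zero    = []
consecutive c (suc m) = c ∷ consecutive (suc c) m

applyUpTo≡consecutive : (f : ℕ → ℕ) → (∀ i → f (suc i) ≡ suc (f i)) →
  (m : ℕ) → applyUpTo f m ≡ consecutive (f 0) m
applyUpTo≡consecutive f f-step zero    = refl
applyUpTo≡consecutive f f-step (suc m) = cong (f 0 ∷_)
  (trans (applyUpTo≡consecutive (f ∘ suc) (f-step ∘ suc) m) (cong (λ c → consecutive c m) (f-step 0)))

consecutive-≥ : (c m : ℕ) → All (c ≤_) (consecutive c m)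
consecutive-≥ c zero    = []
consecutive-≥ c (suc m) = ℕ.≤-refl ∷ All.map ℕ.<⇒≤ (consecutive-≥ (suc c) m)

stack-above : {a : ℕ} {as : List ℕ} (H : List (Vec ℕ k)) → All (a <_) as → All (Above a) (stack as H)
stack-above H []          = []
stack-above H (a<b ∷ a<as) = All.++⁺ (All.map⁺ (All.universal (λ _ → a<b) H)) (stack-above H a<as)

P₋₁-stack : (H : List (Vec ℕ k)) (c m : ℕ) → P₋₁ (stack (consecutive c m) H) ≡ P₋₁ H ^ ⌈ m /2⌉
P₋₁-stack H c zero          = refl
P₋₁-stack H c (suc zero)    =
  trans (cong P₋₁ (List.++-identityʳ (layer c H))) (trans (P₋₁-layer c H) (sym (ℤ.^-identityʳ (P₋₁ H))))
P₋₁-stack H c (suc (suc m)) =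
  trans (P₋₁-twoLayers c H (stack-above H (consecutive-≥ (suc (suc c)) m)))
        (cong (P₋₁ H *_) (P₋₁-stack H (suc (suc c)) m))

P₋₁-kingVertices : (n : Vec ℕ k) → P₋₁ (kingVertices n) ≡ -1ℤ ^ ceilHalfProduct n
P₋₁-kingVertices []       = refl
P₋₁-kingVertices {suc k} (m ∷ ns) = begin
  P₋₁ (stack (map suc (upTo m)) H)
    ≡⟨ cong (λ as → P₋₁ (stack as H))
         (trans (List.map-upTo suc m) (applyUpTo≡consecutive suc (λ _ → refl) m)) ⟩
  P₋₁ (stack (consecutive 1 m) H)
    ≡⟨ P₋₁-stack H 1 m ⟩
  P₋₁ H ^ ⌈ m /2⌉
    ≡⟨ cong (_^ ⌈ m /2⌉) (P₋₁-kingVertices ns) ⟩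
  (-1ℤ ^ ceilHalfProduct ns) ^ ⌈ m /2⌉
    ≡⟨ ℤ.^-*-assoc -1ℤ (ceilHalfProduct ns) ⌈ m /2⌉ ⟩
  -1ℤ ^ (ceilHalfProduct ns *ℕ ⌈ m /2⌉)
    ≡⟨ cong (-1ℤ ^_) (ℕ.*-comm (ceilHalfProduct ns) ⌈ m /2⌉) ⟩
  -1ℤ ^ ceilHalfProduct (m ∷ ns) ∎
  where
  open ≡-Reasoning
  H : List (Vec ℕ k)
  H = kingVertices ns

theorem2 : (d : ℕ) → 1 ≤ d → (n : Vec ℕ d) →
    dominationPolyAt (kingGraph n) -1ℤ ≡ -1ℤ ^ ceilHalfProduct n
theorem2 d _ n = trans (dominationPolyAt-kingGraph n) (P₋₁-kingVertices n)
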